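{- Let $k\ge 1$ and $n\ge 4$ be integers. There exists a universal cycle for the set of all $n$-letter words over the alphabet $[k]=\{1,\dots,k\}$ in which at least one letter is repeated (equivalently, non-injective functions $\{1,\dots,n\}\to\{1,\dots,k\}$).
   Context: For a set $\mathcal{C}$ of $n$-letter words over an alphabet, a universal cycle (U-cycle) for $\mathcal{C}$ is a cyclic sequence $x_1x_2\dots x_N$ with $N=|\mathcal{C}|$ such that the $N$ words $x_ix_{i+1}\dots x_{i+n-1}$ ($1\le i\le N$, indices taken modulo $N$) are exactly the words of $\mathcal{C}$, each occurring exactly once. -}

module Defs where

open import Data.Nat using (ℕ; suc; _+_)
open import Data.Nat.DivMod using (_mod_)
open import Data.Fin using (Fin; toℕ)
open import Data.Vec using (Vec; tabulate; lookup)
open import Data.Product using (Σ; _×_; ∃)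
open import Relation.Binary.PropositionalEquality using (_≡_)
open import Relation.Nullary using (¬_)

Word : ℕ → ℕ → Set
Word k n = Vec (Fin k) n

HasRepeat : ∀ {k n} → Word k n → Set
HasRepeat {k} {n} w = Σ (Fin n) λ i → Σ (Fin n) λ j → ¬ (i ≡ j) × (lookup w i ≡ lookup w j)

cyc : ∀ {M} → Fin (suc M) → ℕ → Fin (suc M)
cyc {M} i j = (toℕ i + j) mod (suc M)

window : ∀ {k M} (n : ℕ) → (Fin (suc M) → Fin k) → Fin (suc M) → Word k n
window n x i = tabulate λ j → x (cyc i (toℕ j))

IsUCycle : ∀ {k M} (n : ℕ) (C : Word k n → Set) → (Fin (suc M) → Fin k) → Set
IsUCycle n C x =
  (∀ i → C (window n x i)) ×
  (∀ w → C w → Σ _ λ i → (window n x i ≡ w) × (∀ i' → window n x i' ≡ w → i' ≡ i))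

HasUCycle : (k n : ℕ) → (Word k n → Set) → Set
HasUCycle k n C = Σ ℕ λ M → Σ (Fin (suc M) → Fin k) λ x → IsUCycle n C x

module Submission where

-- The class C of such words is closed under rotation, so it splits into
-- rotation classes; listed cyclically, each class is a cycle of words in
-- which every word overlaps the next (drop the first letter of one, the last
-- letter of the next, and the results agree).  Two disjoint cycles through
-- words u = a·s and v = b·s with the same tail s can be spliced into one:
-- after v enter u's cycle at the successor of u, and after u return to v's
-- cycle at the successor of v.  Starting from the class of the all-zero word
-- and splicing in one missing class at a time yields a single duplicate-free
-- cycle of overlapping words listing all of C, and the first letters of its
-- words form the universal cycle.

open import Defs
open import Data.Nat using (ℕ; _≤_)

open import Data.Nat using (zero; suc; _+_; _*_; _<_; z≤n; s≤s; NonZero)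
open import Data.Nat.DivMod using (_mod_; _%_; _/_; m≡m%n+[m/n]*n; m%n<n)
open import Data.Nat.Properties
  using (suc-injective; <-cmp; ≤-trans; ≤-reflexive; m≤n⇒m<n∨m≡n; n≤1+n; m≤n+m; m<m+n; ≤⇒≯; m≤n⇒∃[o]m+o≡n;
         +-identityʳ; +-suc; +-comm; +-assoc; +-monoˡ-≤; module ≤-Reasoning)
open import Data.Nat.GeneralisedArithmetic using (iterate)
open import Data.List using (List; []; _∷_; _++_; [_]; length; map; cartesianProductWith; allFin)
open import Data.List.Base using () renaming (iterate to orbit)
open import Data.List.Properties using (++-assoc; ++-identityʳ; length-++; map-id)
open import Data.List.Membership.Propositional using (_∈_; _∉_; lose)
open import Data.List.Membership.Propositional.Properties using (∈-++⁺ˡ; ∈-++⁺ʳ; ∈-++⁻; ∈-∃++; ∈-cartesianProductWith⁺; ∈-allFin)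
open import Data.List.Relation.Unary.Any using (here; there; any?; satisfied)
open import Data.List.Relation.Unary.AllPairs using ([]; _∷_)
open import Data.List.Relation.Unary.Unique.Propositional using (Unique)
open import Data.List.Relation.Unary.Unique.Propositional.Properties using (Unique[x∷xs]⇒x∉xs; ++⁺)
open import Data.List.Relation.Binary.Subset.Propositional using (_⊆_)
open import Data.List.Relation.Binary.Permutation.Propositional using (_↭_; prep; ↭-refl; ↭-trans; ↭-sym; ↭⇒↭ₛ′)
open import Data.List.Relation.Binary.Permutation.Propositional.Properties using (∈-resp-↭; ↭-length; ↭-empty-inv; shift; ++-comm)
import Data.List.Relation.Binary.Permutation.Setoid.Properties as PermutationSetoid
open import Data.List.Relation.Binary.Disjoint.Propositional using (Disjoint)
open import Relation.Binary.Construct.Closure.ReflexiveTransitive using (Star; ε; _◅_; _◅◅_)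
open import Data.List.Relation.Unary.All using (All) renaming (tabulate to all-tabulate)
import Data.Fin as Fin
import Data.Fin.Properties as Finₚ
open import Data.Fin using (Fin; zero; suc; toℕ; inject₁; fromℕ<)
open import Data.Fin.Properties using (toℕ-inject₁; toℕ-fromℕ<; toℕ-injective; toℕ<n)
import Data.Vec as Vec
import Data.Vec.Properties as Vecₚ
open import Data.Vec using (Vec; []; _∷_; _∷ʳ_; tail; init; lookup; toList)
open import Data.Vec.Properties using (≡-dec; tabulate-cong; tabulate∘lookup; init-∷ʳ; toList-∷ʳ; toList-injective; length-toList; toList-map; ∷ʳ-injective)
open import Data.Vec.Relation.Binary.Equality.Cast using (cast-is-id)
open import Data.Vec.Membership.Propositional.Properties using (∈-toList⁺; ∈-toList⁻) renaming (∈-lookup to ∈-lookupᵥ)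
import Data.Vec.Relation.Unary.Any as Anyᵥ
open import Data.Vec.Relation.Unary.Any.Properties using (lookup-index)
open import Data.Product using (Σ; _×_; _,_; ∃; ∃₂; proj₁; proj₂)
open import Data.Sum using (_⊎_; inj₁; inj₂; [_,_]′)
open import Data.Unit using (⊤)
open import Function using (id; const)
open import Relation.Nullary using (¬_; ¬?; yes; no; contradiction)
open import Relation.Nullary.Decidable using (_×-dec_)
open import Relation.Unary using (Decidable)
open import Relation.Binary.Definitions using (DecidableEquality; tri<; tri≈; tri>)
open import Relation.Binary.PropositionalEquality using (_≡_; _≢_; refl; sym; trans; cong; subst; setoid; isEquivalence; module ≡-Reasoning)

module _ {A : Set} where

  unique-resp-↭ : {xs ys : List A} → xs ↭ ys → Unique xs → Unique ys
  unique-resp-↭ p = PermutationSetoid.Unique-resp-↭ (setoid A) (↭⇒↭ₛ′ isEquivalence p)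

  unique⇒length≤ : {xs ys : List A} → Unique xs → xs ⊆ ys → length xs ≤ length ys
  unique⇒length≤ {[]} _ _ = z≤n
  unique⇒length≤ {x ∷ xs} u@(_ ∷ u-xs) xs⊆ys with ∈-∃++ (xs⊆ys (here refl))
  ... | P , Q , refl =
    subst (suc (length xs) ≤_) (sym (↭-length (shift x P Q))) (s≤s (unique⇒length≤ u-xs xs⊆P++Q))
    where
    xs⊆P++Q : xs ⊆ P ++ Q
    xs⊆P++Q y∈xs with ∈-resp-↭ (shift x P Q) (xs⊆ys (there y∈xs))
    ... | here refl = contradiction y∈xs (Unique[x∷xs]⇒x∉xs u)
    ... | there y∈P++Q = y∈P++Q

  -- Drop the first entry and append its image under h.  For h = id this is
  -- cyclic rotation; for a constant h it shifts a fixed letter in from the right.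
  shiftWith : (A → A) → List A → List A
  shiftWith h [] = []
  shiftWith h (x ∷ xs) = xs ++ [ h x ]

  shiftWith-++ : ∀ h X Y → iterate (shiftWith h) (X ++ Y) (length X) ≡ Y ++ map h X
  shiftWith-++ h [] Y = sym (++-identityʳ Y)
  shiftWith-++ h (x ∷ X) Y = begin
      iterate (shiftWith h) ((X ++ Y) ++ [ h x ]) (length X)
    ≡⟨ cong (λ L → iterate (shiftWith h) L (length X)) (++-assoc X Y [ h x ]) ⟩
      iterate (shiftWith h) (X ++ (Y ++ [ h x ])) (length X)
    ≡⟨ shiftWith-++ h X (Y ++ [ h x ]) ⟩
      (Y ++ [ h x ]) ++ map h X
    ≡⟨ ++-assoc Y [ h x ] (map h X) ⟩
      Y ++ map h (x ∷ X) ∎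
    where open ≡-Reasoning

  rotate : List A → List A
  rotate = shiftWith id

  rotate-↭ : (xs : List A) → rotate xs ↭ xs
  rotate-↭ [] = ↭-refl
  rotate-↭ (x ∷ xs) = ++-comm xs [ x ]

  rotate-++ : ∀ X Y → iterate rotate (X ++ Y) (length X) ≡ Y ++ X
  rotate-++ X Y = trans (shiftWith-++ id X Y) (cong (Y ++_) (map-id X))

  rotate-period : ∀ X → iterate rotate X (length X) ≡ X
  rotate-period X = begin
      iterate rotate X (length X)           ≡⟨ cong (λ L → iterate rotate L (length X)) (sym (++-identityʳ X)) ⟩
      iterate rotate (X ++ []) (length X)   ≡⟨ rotate-++ X [] ⟩
      X                                     ∎
    where open ≡-Reasoning

  module _ (R : A → A → Set) where

    Chain : A → List A → A → Set
    Chain x [] y = R x y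
    Chain x (z ∷ zs) y = R x z × Chain z zs y

    chain-++⁻ : ∀ x X z Y y → Chain x (X ++ z ∷ Y) y → Chain x X z × Chain z Y y
    chain-++⁻ x [] z Y y (r , c) = r , c
    chain-++⁻ x (w ∷ X) z Y y (r , c) with chain-++⁻ w X z Y y c
    ... | c₁ , c₂ = (r , c₁) , c₂

    chain-++⁺ : ∀ x X z Y y → Chain x X z → Chain z Y y → Chain x (X ++ z ∷ Y) y
    chain-++⁺ x [] z Y y r c = r , c
    chain-++⁺ x (w ∷ X) z Y y (r , c₁) c₂ = r , chain-++⁺ w X z Y y c₁ c₂

    chain-source : ∀ {x x′} → (∀ {z} → R x z → R x′ z) → ∀ L {y} → Chain x L y → Chain x′ L y
    chain-source f [] r = f r
    chain-source f (z ∷ L) (r , c) = f r , c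

    Cyclic : List A → Set
    Cyclic [] = ⊤
    Cyclic (x ∷ xs) = Chain x xs x

    cyclic-swap : ∀ X Y → Cyclic (X ++ Y) → Cyclic (Y ++ X)
    cyclic-swap [] Y c rewrite ++-identityʳ Y = c
    cyclic-swap (x ∷ X) [] c rewrite ++-identityʳ X = c
    cyclic-swap (x ∷ X) (y ∷ Y) c with chain-++⁻ x X y Y x c
    ... | c₁ , c₂ = chain-++⁺ y Y x X y c₂ c₁

    cyclic-rotate : ∀ X → Cyclic X → Cyclic (rotate X)
    cyclic-rotate [] c = c
    cyclic-rotate (x ∷ X) c = cyclic-swap [ x ] X c

module _ {A : Set} (f : A → A) where

  iterate-comm : ∀ x j → f (iterate f x j) ≡ iterate f (f x) j
  iterate-comm x zero = refl
  iterate-comm x (suc j) = iterate-comm (f x) j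

  iterate-+ : ∀ x a b → iterate f x (a + b) ≡ iterate f (iterate f x a) b
  iterate-+ x zero b = refl
  iterate-+ x (suc a) b = iterate-+ (f x) a b

  iterate-natural : {B : Set} (g : B → B) (h : A → B) → (∀ x → h (f x) ≡ g (h x)) →
                    ∀ x i → h (iterate f x i) ≡ iterate g (h x) i
  iterate-natural g h commute x zero = refl
  iterate-natural g h commute x (suc i) =
    trans (iterate-natural g h commute (f x) i) (cong (λ y → iterate g y i) (commute x))

  iterate-pres : (P : A → Set) → (∀ {x} → P x → P (f x)) → ∀ {x} j → P x → P (iterate f x j)
  iterate-pres P pres zero p = p
  iterate-pres P pres (suc j) p = iterate-pres P pres j (pres p)

  orbit-∈⁻ : ∀ p y {z} → z ∈ orbit f y p → ∃ λ i → i < p × z ≡ iterate f y i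
  orbit-∈⁻ (suc p) y (here refl) = 0 , s≤s z≤n , refl
  orbit-∈⁻ (suc p) y (there z∈) with orbit-∈⁻ p (f y) z∈
  ... | i , i<p , eq = suc i , s≤s i<p , eq

  orbit-∈⁺ : ∀ p y i → i < p → iterate f y i ∈ orbit f y p
  orbit-∈⁺ (suc p) y zero _ = here refl
  orbit-∈⁺ (suc p) y (suc i) (s≤s i<p) = there (orbit-∈⁺ p (f y) i i<p)

  orbit-closed : ∀ p y {z} → iterate f y p ≡ y → z ∈ orbit f y p → f z ∈ orbit f y p
  orbit-closed p y period z∈ with orbit-∈⁻ p y z∈
  ... | i , i<p , refl with m≤n⇒m<n∨m≡n i<p
  ...   | inj₁ 1+i<p = subst (_∈ orbit f y p) (sym (iterate-comm y i)) (orbit-∈⁺ p y (suc i) 1+i<p)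
  ...   | inj₂ refl = subst (_∈ orbit f y (suc i)) (sym (trans (iterate-comm y i) period)) (here refl)

  orbit-unique : (∀ {a b} → f a ≡ f b → a ≡ b) → ∀ p y →
                 (∀ d → 0 < d → d < p → iterate f y d ≢ y) → Unique (orbit f y p)
  orbit-unique inj zero y _ = []
  orbit-unique inj (suc p) y aperiodic = y∉ ∷ orbit-unique inj p (f y) aperiodic′
    where
    y∉ : All (y ≢_) (orbit f (f y) p)
    y∉ = all-tabulate λ z∈ y≡z → let i , i<p , eq = orbit-∈⁻ p (f y) z∈ in
      aperiodic (suc i) (s≤s z≤n) (s≤s i<p) (sym (trans y≡z eq))
    aperiodic′ : ∀ d → 0 < d → d < p → iterate f (f y) d ≢ f y
    aperiodic′ d 0<d d<p eq = aperiodic d 0<d (≤-trans d<p (n≤1+n p)) (inj (trans (iterate-comm y d) eq))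

  orbit-chain : (R : A → A → Set) → (∀ x → R x (f x)) → ∀ q y →
                Chain R y (orbit f (f y) q) (iterate f (f y) q)
  orbit-chain R step zero y = step y
  orbit-chain R step (suc q) y = step y , orbit-chain R step q (f y)

least : {P : ℕ → Set} → Decidable P → ∀ n → P n → ∃ λ p → P p × (∀ d → d < p → ¬ P d)
least P? zero P0 = 0 , P0 , λ _ ()
least P? (suc n) Pn with P? 0
... | yes P0 = 0 , P0 , λ _ ()
... | no ¬P0 with least (λ d → P? (suc d)) n Pn
...   | p , Pp , below = suc p , Pp , λ { zero _ → ¬P0 ; (suc d) (s≤s d<p) → below d d<p }

periodic-mod : {X : Set} (f : ℕ → X) (N : ℕ) .{{_ : NonZero N}} →
               (∀ a → f (a + N) ≡ f a) → ∀ a → f (a % N) ≡ f a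
periodic-mod f N period a = begin
    f (a % N)                    ≡⟨ sym (multiples (a / N) (a % N)) ⟩
    f (a % N + (a / N) * N)      ≡⟨ cong f (sym (m≡m%n+[m/n]*n a N)) ⟩
    f a                          ∎
  where
  open ≡-Reasoning
  multiples : ∀ q r → f (r + q * N) ≡ f r
  multiples zero r = cong f (+-identityʳ r)
  multiples (suc q) r = begin
      f (r + (N + q * N))   ≡⟨ cong (λ a → f (r + a)) (+-comm N (q * N)) ⟩
      f (r + (q * N + N))   ≡⟨ cong f (sym (+-assoc r (q * N) N)) ⟩
      f (r + q * N + N)     ≡⟨ period (r + q * N) ⟩
      f (r + q * N)         ≡⟨ multiples q r ⟩
      f r                   ∎

module _ {A : Set} where

  shiftWithᵥ : ∀ {j} → (A → A) → Vec A (suc j) → Vec A (suc j)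
  shiftWithᵥ h (x ∷ xs) = xs ∷ʳ h x

  toList-shiftWithᵥ : ∀ {j} h (w : Vec A (suc j)) → toList (shiftWithᵥ h w) ≡ shiftWith h (toList w)
  toList-shiftWithᵥ h (x ∷ xs) = toList-∷ʳ (h x) xs

  shiftWithᵥ-all : ∀ {j} h (w : Vec A (suc j)) → iterate (shiftWithᵥ h) w (suc j) ≡ Vec.map h w
  shiftWithᵥ-all {j} h w = trans (sym (cast-is-id refl _)) (toList-injective refl _ _ (begin
      toList (iterate (shiftWithᵥ h) w (suc j))
    ≡⟨ iterate-natural (shiftWithᵥ h) (shiftWith h) toList (toList-shiftWithᵥ h) w (suc j) ⟩
      iterate (shiftWith h) (toList w) (suc j)
    ≡⟨ cong (iterate (shiftWith h) (toList w)) (sym (length-toList w)) ⟩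
      iterate (shiftWith h) (toList w) (length (toList w))
    ≡⟨ cong (λ L → iterate (shiftWith h) L (length (toList w))) (sym (++-identityʳ (toList w))) ⟩
      iterate (shiftWith h) (toList w ++ []) (length (toList w))
    ≡⟨ shiftWith-++ h (toList w) [] ⟩
      map h (toList w)
    ≡⟨ sym (toList-map h w) ⟩
      toList (Vec.map h w) ∎))
    where open ≡-Reasoning

  rot : ∀ {j} → Vec A (suc j) → Vec A (suc j)
  rot = shiftWithᵥ id

  rot-period : ∀ {j} (w : Vec A (suc j)) → iterate rot w (suc j) ≡ w
  rot-period w = trans (shiftWithᵥ-all id w) (Vecₚ.map-id w)

  rot-injective : ∀ {j} {x y : Vec A (suc j)} → rot x ≡ rot y → x ≡ y
  rot-injective {x = a ∷ xs} {b ∷ ys} eq with ∷ʳ-injective xs ys eq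
  ... | refl , refl = refl

  -- y may follow x in a cyclic sequence: dropping the first letter of x gives
  -- the same word as dropping the last letter of y.
  Overlaps : ∀ {j} → Vec A (suc j) → Vec A (suc j) → Set
  Overlaps x y = tail x ≡ init y

  overlaps-rot : ∀ {j} (x : Vec A (suc j)) → Overlaps x (rot x)
  overlaps-rot (a ∷ xs) = sym (init-∷ʳ a xs)

  overlaps-tail : ∀ {j} {x x′ y : Vec A (suc j)} → tail x ≡ tail x′ → Overlaps x y → Overlaps x′ y
  overlaps-tail t≡t′ o = trans (sym t≡t′) o

  lookup-init : ∀ {j} (v : Vec A (suc j)) (i : Fin j) → lookup (init v) i ≡ lookup v (inject₁ i)
  lookup-init (x ∷ y ∷ ys) zero = refl
  lookup-init (x ∷ y ∷ ys) (suc i) = lookup-init (y ∷ ys) i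

-- Reading off a letter sequence from a nonempty cyclic list of overlapping
-- words: its i-th letter is the first letter of the i-th word (indices mod N).
module Reading {k m : ℕ} (l : Word k (suc m)) (ls : List (Word k (suc m)))
               (cyclic : Cyclic Overlaps (l ∷ ls)) where

  W : Set
  W = Word k (suc m)

  B : List W
  B = l ∷ ls

  N : ℕ
  N = suc (length ls)

  -- The first entry of a list (l for the empty list, which never occurs below).
  first : List W → W
  first [] = l
  first (x ∷ _) = x

  word : ℕ → W
  word i = first (iterate rotate B i)

  rotations-↭ : ∀ i → iterate rotate B i ↭ B
  rotations-↭ i = iterate-pres rotate (_↭ B) (λ {X} X↭B → ↭-trans (rotate-↭ X) X↭B) i ↭-refl

  word-∈ : ∀ i → word i ∈ B
  word-∈ i with iterate rotate B i | rotations-↭ i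
  ... | [] | X↭B = contradiction (↭-empty-inv (↭-sym X↭B)) λ ()
  ... | x ∷ X | X↭B = ∈-resp-↭ X↭B (here refl)

  -- Each word of the sequence overlaps the next, since rotations of the
  -- cycle are again cyclic.
  word-overlaps : ∀ i → Overlaps (word i) (word (suc i))
  word-overlaps i = subst (λ X → Overlaps (word i) (first X)) (iterate-comm rotate B i)
    (first-overlaps (iterate rotate B i) (rotations-↭ i)
      (iterate-pres rotate (Cyclic Overlaps) (λ {X} → cyclic-rotate Overlaps X) i cyclic))
    where
    first-overlaps : ∀ X → X ↭ B → Cyclic Overlaps X → Overlaps (first X) (first (rotate X))
    first-overlaps [] X↭B _ = contradiction (↭-empty-inv (↭-sym X↭B)) λ ()
    first-overlaps (x ∷ []) _ c = c
    first-overlaps (x ∷ y ∷ X) _ (o , _) = o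

  -- Consecutive words overlap, so the j-th letter of word i is the first
  -- letter of word i + j.
  word-letter : ∀ t (j : Fin (suc m)) → toℕ j ≡ t → ∀ i → lookup (word i) j ≡ lookup (word (i + t)) zero
  word-letter zero zero _ i = cong (λ a → lookup (word a) zero) (sym (+-identityʳ i))
  word-letter (suc t) (suc j) j≡t i = begin
      lookup (word i) (suc j)             ≡⟨ lookup-suc (word i) j ⟩
      lookup (tail (word i)) j            ≡⟨ cong (λ v → lookup v j) (word-overlaps i) ⟩
      lookup (init (word (suc i))) j      ≡⟨ lookup-init (word (suc i)) j ⟩
      lookup (word (suc i)) (inject₁ j)   ≡⟨ word-letter t (inject₁ j) (trans (toℕ-inject₁ j) (suc-injective j≡t)) (suc i) ⟩
      lookup (word (suc i + t)) zero      ≡⟨ cong (λ a → lookup (word a) zero) (sym (+-suc i t)) ⟩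
      lookup (word (i + suc t)) zero      ∎
    where
    open ≡-Reasoning
    lookup-suc : ∀ (v : W) j → lookup v (suc j) ≡ lookup (tail v) j
    lookup-suc (_ ∷ _) j = refl

  word-period : ∀ a → word (a + N) ≡ word a
  word-period a = cong first (begin
      iterate rotate B (a + N)                  ≡⟨ iterate-+ rotate B a N ⟩
      iterate rotate X N                        ≡⟨ cong (iterate rotate X) (sym (↭-length (rotations-↭ a))) ⟩
      iterate rotate X (length X)               ≡⟨ rotate-period X ⟩
      X                                         ∎)
    where
    open ≡-Reasoning
    X = iterate rotate B a

  word-onto : ∀ {w} → w ∈ B → ∃ λ a → a < N × word a ≡ w
  word-onto w∈B with ∈-∃++ w∈B
  ... | P , Q , B≡P++w∷Q = length P , P<N , cong first (begin
      iterate rotate B (length P)                 ≡⟨ cong (λ X → iterate rotate X (length P)) B≡P++w∷Q ⟩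
      iterate rotate (P ++ _ ∷ Q) (length P)      ≡⟨ rotate-++ P (_ ∷ Q) ⟩
      _ ∷ Q ++ P                                  ∎)
    where
    open ≡-Reasoning
    P<N : length P < N
    P<N = subst (length P <_) (sym (trans (cong length B≡P++w∷Q) (length-++ P)))
                (m<m+n (length P) (s≤s z≤n))

  first-∈-prefix : ∀ d xs Z → d < length xs → first (iterate rotate (xs ++ Z) d) ∈ xs
  first-∈-prefix zero (y ∷ ys) Z _ = here refl
  first-∈-prefix (suc d) (y ∷ ys) Z (s≤s d<ys) =
    there (subst (λ X → first (iterate rotate X d) ∈ ys) (sym (++-assoc ys Z [ y ]))
                 (first-∈-prefix d ys (Z ++ [ y ]) d<ys))

  first-rotation-distinct : ∀ Y → Unique Y → ∀ d → suc d < length Y → first Y ≢ first (iterate rotate Y (suc d))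
  first-rotation-distinct (y ∷ Y) uY d (s≤s d<Y) y≡ =
    Unique[x∷xs]⇒x∉xs uY (subst (_∈ Y) (sym y≡) (first-∈-prefix d Y [ y ] d<Y))

  word-distinct : Unique B → ∀ {a b} → a < b → b < N → word a ≢ word b
  word-distinct uB {a} a<b b<N eq with m≤n⇒∃[o]m+o≡n a<b
  ... | d , refl = first-rotation-distinct X (unique-resp-↭ (↭-sym (rotations-↭ a)) uB) d d<
                     (trans eq (cong first (trans (cong (iterate rotate B) (sym (+-suc a d))) (iterate-+ rotate B a (suc d)))))
    where
    X = iterate rotate B a
    d< : suc d < length (iterate rotate B a)
    d< = subst (suc d <_) (sym (↭-length (rotations-↭ a)))
           (≤-trans (s≤s (subst (suc d ≤_) (+-suc a d) (m≤n+m (suc d) a))) b<N)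

  word-injective : Unique B → ∀ {a b} → a < N → b < N → word a ≡ word b → a ≡ b
  word-injective uB {a} {b} a<N b<N eq with <-cmp a b
  ... | tri< a<b _ _ = contradiction eq (word-distinct uB a<b b<N)
  ... | tri≈ _ a≡b _ = a≡b
  ... | tri> _ _ b<a = contradiction (sym eq) (word-distinct uB b<a a<N)

  sequence : Fin N → Fin k
  sequence c = lookup (word (toℕ c)) zero

  window-word : ∀ c → window (suc m) sequence c ≡ word (toℕ c)
  window-word c = trans (tabulate-cong letter) (tabulate∘lookup (word (toℕ c)))
    where
    open ≡-Reasoning
    letter : ∀ j → sequence (cyc c (toℕ j)) ≡ lookup (word (toℕ c)) j
    letter j = begin
      lookup (word (toℕ ((toℕ c + toℕ j) mod N))) zero
        ≡⟨ cong (λ a → lookup (word a) zero) (toℕ-fromℕ< (m%n<n (toℕ c + toℕ j) N)) ⟩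
      lookup (word ((toℕ c + toℕ j) % N)) zero
        ≡⟨ cong (λ v → lookup v zero) (periodic-mod word N word-period (toℕ c + toℕ j)) ⟩
      lookup (word (toℕ c + toℕ j)) zero
        ≡⟨ sym (word-letter (toℕ j) j refl (toℕ c)) ⟩
      lookup (word (toℕ c)) j ∎

  is-ucycle : (C : W → Set) → Unique B → (∀ {x} → x ∈ B → C x) → (∀ {w} → C w → w ∈ B) →
              IsUCycle (suc m) C sequence
  is-ucycle C uB valid cover = (λ c → subst C (sym (window-word c)) (valid (word-∈ (toℕ c)))) , occurs-once
    where
    occurs-once : ∀ w → C w → Σ (Fin N) λ i → (window (suc m) sequence i ≡ w) ×
                                              (∀ i′ → window (suc m) sequence i′ ≡ w → i′ ≡ i)
    occurs-once w Cw with word-onto (cover Cw)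
    ... | a , a<N , word-a≡w = c , trans (window-word c) (trans (cong word (toℕ-fromℕ< a<N)) word-a≡w) , only-c
      where
      c = fromℕ< a<N
      only-c : ∀ i′ → window (suc m) sequence i′ ≡ w → i′ ≡ c
      only-c i′ window-i′≡w = toℕ-injective (trans
        (word-injective uB (toℕ<n i′) a<N (trans (sym (window-word i′)) (trans window-i′≡w (sym word-a≡w))))
        (sym (toℕ-fromℕ< a<N)))

boundary : {A : Set} {R : A → A → Set} (P : A → Set) → Decidable P →
           ∀ {x y} → Star R x y → ¬ P x → P y → ∃₂ λ u v → ¬ P u × P v × R u v
boundary P P? ε ¬Px Py = contradiction Py ¬Px
boundary P P? (_◅_ {j = z} r path) ¬Px Py with P? z
... | yes Pz = _ , _ , ¬Px , Pz , r
... | no ¬Pz = boundary P P? path ¬Pz Py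

Link : ∀ {A : Set} {j} → (Vec A (suc j) → Set) → Vec A (suc j) → Vec A (suc j) → Set
Link C x y = C x × (y ≡ rot x ⊎ tail x ≡ tail y)

module CycleJoining
  {k m : ℕ}
  (C : Word k (suc m) → Set)
  (C? : Decidable C)
  (C-rot : ∀ {w} → C w → C (rot w))
  (universe : List (Word k (suc m)))
  (universe-complete : ∀ {w} → C w → w ∈ universe)
  (hub : Word k (suc m))
  (C-hub : C hub)
  (reach-hub : ∀ {w} → C w → Star (Link C) w hub)
  where

  W : Set
  W = Word k (suc m)

  _≟W_ : DecidableEquality W
  _≟W_ = ≡-dec Fin._≟_

  open import Data.List.Membership.DecPropositional _≟W_ using (_∈?_)

  record Closed (B : List W) : Set where
    field
      unique     : Unique B
      valid      : ∀ {x} → x ∈ B → C x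
      rot-closed : ∀ {x} → x ∈ B → rot x ∈ B

  closed-resp-↭ : ∀ {B B′} → B ↭ B′ → Closed B → Closed B′
  closed-resp-↭ B↭B′ cl = record
    { unique     = unique-resp-↭ B↭B′ unique
    ; valid      = λ x∈B′ → valid (∈-resp-↭ (↭-sym B↭B′) x∈B′)
    ; rot-closed = λ x∈B′ → ∈-resp-↭ B↭B′ (rot-closed (∈-resp-↭ (↭-sym B↭B′) x∈B′))
    }
    where open Closed cl

  closed-++ : ∀ {X Y} → Closed X → Closed Y → Disjoint X Y → Closed (X ++ Y)
  closed-++ {X} clX clY X#Y = record
    { unique     = ++⁺ (Closed.unique clX) (Closed.unique clY) X#Y
    ; valid      = λ x∈ → [ Closed.valid clX , Closed.valid clY ]′ (∈-++⁻ X x∈)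
    ; rot-closed = λ x∈ → [ (λ x∈X → ∈-++⁺ˡ (Closed.rot-closed clX x∈X))
                          , (λ x∈Y → ∈-++⁺ʳ X (Closed.rot-closed clY x∈Y)) ]′ (∈-++⁻ X x∈)
    }

  -- A rotation-closed list containing some rotation of u contains u itself,
  -- since rotating m more times undoes one rotation.
  rotations-back : ∀ {B : List W} → (∀ {x} → x ∈ B → rot x ∈ B) → ∀ u i → iterate rot u i ∈ B → u ∈ B
  rotations-back closed u zero u∈B = u∈B
  rotations-back {B} closed u (suc i) rot-u∈B =
    subst (_∈ B) (rot-period u) (iterate-pres rot (_∈ B) closed m (rotations-back closed (rot u) i rot-u∈B))

  record Partial (B : List W) : Set where
    field
      closed : Closed B
      cyclic : Cyclic Overlaps B

  partial-swap : ∀ X Y → Partial (X ++ Y) → Partial (Y ++ X)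
  partial-swap X Y pc = record
    { closed = closed-resp-↭ (++-comm X Y) (Partial.closed pc)
    ; cyclic = cyclic-swap Overlaps X Y (Partial.cyclic pc)
    }

  orbit-partial : ∀ {u} → C u → ∃ λ E → Partial (u ∷ E) × (∀ {x} → x ∈ u ∷ E → ∃ λ i → x ≡ iterate rot u i)
  orbit-partial {u} Cu = orbit rot (rot u) q , pc , rotations
    where
    period = least (λ d → iterate rot u (suc d) ≟W u) m (rot-period u)
    q = proj₁ period
    q-period : iterate rot u (suc q) ≡ u
    q-period = proj₁ (proj₂ period)
    rotations : ∀ {x} → x ∈ orbit rot u (suc q) → ∃ λ i → x ≡ iterate rot u i
    rotations x∈ = let i , _ , eq = orbit-∈⁻ rot (suc q) u x∈ in i , eq
    pc : Partial (orbit rot u (suc q))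
    pc = record
      { closed = record
        { unique     = orbit-unique (rot {j = m}) rot-injective (suc q) u
                         λ { (suc d) _ (s≤s d<q) → proj₂ (proj₂ period) d d<q }
        ; valid      = λ x∈ → let i , eq = rotations x∈ in subst C (sym eq) (iterate-pres rot C C-rot i Cu)
        ; rot-closed = orbit-closed rot (suc q) u q-period
        }
      ; cyclic = subst (Chain Overlaps u (orbit rot (rot u) q)) q-period
                       (orbit-chain (rot {j = m}) Overlaps overlaps-rot q u)
      }

  splice-↭ : ∀ u v (E D : List W) → v ∷ E ++ u ∷ D ↭ (v ∷ D) ++ (u ∷ E)
  splice-↭ u v E D = prep v (↭-trans (shift u E D) (↭-trans (prep u (++-comm E D)) (↭-sym (shift u D E))))

  -- Cycle joining: two disjoint partial cycles through words u and v with the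
  -- same tail merge into one, by entering u's cycle after v and returning to
  -- v's cycle after u.
  splice : ∀ {u v E D} → tail u ≡ tail v → Partial (v ∷ D) → Partial (u ∷ E) →
           Disjoint (v ∷ D) (u ∷ E) → Partial (v ∷ E ++ u ∷ D)
  splice {u} {v} {E} {D} tu≡tv pv pu v#u = record
    { closed = closed-resp-↭ (↭-sym (splice-↭ u v E D)) (closed-++ (Partial.closed pv) (Partial.closed pu) v#u)
    ; cyclic = chain-++⁺ Overlaps v E u D v
                 (chain-source Overlaps (overlaps-tail {x = u} {x′ = v} tu≡tv) E (Partial.cyclic pu))
                 (chain-source Overlaps (overlaps-tail {x = v} {x′ = u} (sym tu≡tv)) D (Partial.cyclic pv))
    }

  -- Along a path from w to the
  -- hub, some link u → v enters the cycle.  It is not a rotation, as the cycle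
  -- is rotation-closed; so u and v share their tail, and the rotation class of
  -- u (disjoint from the cycle, again by rotation-closure) is spliced in at v.
  extend : ∀ {B w} → Partial B → hub ∈ B → C w → w ∉ B →
           ∃ λ B′ → Partial B′ × B ⊆ B′ × length B < length B′
  extend {B} pc hub∈B Cw w∉B with boundary (_∈ B) (_∈? B) (reach-hub Cw) w∉B hub∈B
  ... | u , _ , u∉B , rot-u∈B , (_ , inj₁ refl) =
    contradiction (rotations-back (Closed.rot-closed (Partial.closed pc)) u 1 rot-u∈B) u∉B
  ... | u , v , u∉B , v∈B , (Cu , inj₂ tu≡tv) with ∈-∃++ v∈B | orbit-partial Cu
  ...   | P , Q , refl | E , pu , rotations = v ∷ E ++ u ∷ Q ++ P , splice tu≡tv pv pu v#u , B⊆B′ , B<B′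
    where
    V = v ∷ Q ++ P
    B↭V : P ++ v ∷ Q ↭ V
    B↭V = ++-comm P (v ∷ Q)
    B′↭ : v ∷ E ++ u ∷ Q ++ P ↭ V ++ u ∷ E
    B′↭ = splice-↭ u v E (Q ++ P)
    pv : Partial V
    pv = partial-swap P (v ∷ Q) pc
    v#u : Disjoint V (u ∷ E)
    v#u (x∈V , x∈U) with rotations x∈U
    ... | i , refl =
      u∉B (∈-resp-↭ (↭-sym B↭V) (rotations-back (Closed.rot-closed (Partial.closed pv)) u i x∈V))
    B⊆B′ : P ++ v ∷ Q ⊆ v ∷ E ++ u ∷ Q ++ P
    B⊆B′ x∈B = ∈-resp-↭ (↭-sym B′↭) (∈-++⁺ˡ (∈-resp-↭ B↭V x∈B))
    B<B′ : length (P ++ v ∷ Q) < length (v ∷ E ++ u ∷ Q ++ P)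
    B<B′ = begin-strict
      length (P ++ v ∷ Q)              ≡⟨ ↭-length B↭V ⟩
      length V                         <⟨ m<m+n (length V) (s≤s z≤n) ⟩
      length V + length (u ∷ E)        ≡⟨ sym (length-++ V) ⟩
      length (V ++ u ∷ E)              ≡⟨ ↭-length (↭-sym B′↭) ⟩
      length (v ∷ E ++ u ∷ Q ++ P)     ∎
      where open ≤-Reasoning

  Saturated : Set
  Saturated = ∃ λ B → Partial B × hub ∈ B × (∀ {w} → C w → w ∈ B)

  covers? : ∀ B → (∀ {w} → C w → w ∈ B) ⊎ ∃ λ w → C w × w ∉ B
  covers? B with any? (λ w → C? w ×-dec ¬? (w ∈? B)) universe
  ... | yes missing = inj₂ (satisfied missing)
  ... | no ¬missing = inj₁ covered
    where
    covered : ∀ {w} → C w → w ∈ B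
    covered {w} Cw with w ∈? B
    ... | yes w∈B = w∈B
    ... | no w∉B = contradiction (lose (universe-complete Cw) (Cw , w∉B)) ¬missing

  -- Extending until every C-word is covered; each round lengthens the cycle,
  -- and a partial cycle (duplicate-free, inside the universe) is never longer
  -- than the universe, so the fuel never runs out.
  saturate : ∀ fuel {B} → Partial B → hub ∈ B → length universe < length B + fuel → Saturated
  saturate fuel {B} pc hub∈B bound with covers? B
  saturate fuel {B} pc hub∈B bound | inj₁ cover = B , pc , hub∈B , cover
  saturate zero {B} pc hub∈B bound | inj₂ _ =
    contradiction (subst (length universe <_) (+-identityʳ (length B)) bound) (≤⇒≯ B≤universe)
    where
    B≤universe : length B ≤ length universe
    B≤universe = unique⇒length≤ (Closed.unique (Partial.closed pc))
                   (λ x∈B → universe-complete (Closed.valid (Partial.closed pc) x∈B))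
  saturate (suc fuel) {B} pc hub∈B bound | inj₂ (w , Cw , w∉B) with extend pc hub∈B Cw w∉B
  ... | B′ , pc′ , B⊆B′ , B<B′ = saturate fuel pc′ (B⊆B′ hub∈B)
          (≤-trans bound (≤-trans (≤-reflexive (+-suc (length B) fuel)) (+-monoˡ-≤ fuel B<B′)))

  saturated : Saturated
  saturated with orbit-partial C-hub
  ... | E , pc , _ =
    saturate (suc (length universe)) pc (here refl) (m≤n+m (suc (length universe)) (length (hub ∷ E)))

  ucycle : HasUCycle k (suc m) C
  ucycle with saturated
  ... | [] , _ , () , _
  ... | l ∷ ls , pc , _ , cover =
    length ls , sequence , is-ucycle C (Closed.unique closed) (Closed.valid closed) cover
    where
    open Partial pc
    open Reading l ls cyclic

ucycle-resp : ∀ {k n} {C D : Word k n → Set} → (∀ {w} → C w → D w) → (∀ {w} → D w → C w) →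
              HasUCycle k n C → HasUCycle k n D
ucycle-resp C⇒D D⇒C (M , x , valid , once) = M , x , (λ i → C⇒D (valid i)) , λ w Dw → once w (D⇒C Dw)

words : ∀ k n → List (Word k n)
words k zero = [ [] ]
words k (suc n) = cartesianProductWith _∷_ (allFin k) (words k n)

words-complete : ∀ {k n} (w : Word k n) → w ∈ words k n
words-complete [] = here refl
words-complete (a ∷ w) = ∈-cartesianProductWith⁺ _∷_ (∈-allFin a) (words-complete w)

module _ {A : Set} where

  data Repeats : List A → Set where
    now   : ∀ {x xs} → x ∈ xs → Repeats (x ∷ xs)
    later : ∀ {x xs} → Repeats xs → Repeats (x ∷ xs)

  repeats-++ʳ : ∀ {xs} ys → Repeats xs → Repeats (xs ++ ys)
  repeats-++ʳ ys (now x∈xs) = now (∈-++⁺ˡ x∈xs)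
  repeats-++ʳ ys (later r) = later (repeats-++ʳ ys r)

  repeats-snoc : ∀ {y} xs → y ∈ xs → Repeats (xs ++ [ y ])
  repeats-snoc (x ∷ xs) (here refl) = now (∈-++⁺ʳ xs (here refl))
  repeats-snoc (x ∷ xs) (there y∈xs) = later (repeats-snoc xs y∈xs)

  repeats-rotate : ∀ {x} xs → Repeats (x ∷ xs) → Repeats (xs ++ [ x ])
  repeats-rotate xs (now x∈xs) = repeats-snoc xs x∈xs
  repeats-rotate xs (later r) = repeats-++ʳ _ r

  repeats? : DecidableEquality A → Decidable Repeats
  repeats? _≟_ [] = no λ ()
  repeats? _≟_ (x ∷ xs) with x ∈? xs | repeats? _≟_ xs
    where open import Data.List.Membership.DecPropositional _≟_ using (_∈?_)
  ... | yes x∈xs | _ = yes (now x∈xs)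
  ... | no _ | yes r = yes (later r)
  ... | no x∉xs | no ¬r = no λ { (now x∈xs) → x∉xs x∈xs ; (later r) → ¬r r }

  Repeated : ∀ {j} → Vec A j → Set
  Repeated w = Repeats (toList w)

  repeated-rot : ∀ {j} {w : Vec A (suc j)} → Repeated w → Repeated (rot w)
  repeated-rot {w = x ∷ xs} r = subst Repeats (sym (toList-∷ʳ x xs)) (repeats-rotate (toList xs) r)

  ∈-∷ʳ : ∀ {j} (v : Vec A j) a → a ∈ toList (v ∷ʳ a)
  ∈-∷ʳ v a = subst (a ∈_) (sym (toList-∷ʳ a v)) (∈-++⁺ʳ (toList v) (here refl))

  repeated-∷ʳ : ∀ {j} (v : Vec A j) {a} → a ∈ toList v → Repeated (v ∷ʳ a)
  repeated-∷ʳ v {a} a∈v = subst Repeats (sym (toList-∷ʳ a v)) (repeats-snoc (toList v) a∈v)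

module _ {k : ℕ} where

  hasRepeat⇒repeated : ∀ {j} (w : Word k j) → HasRepeat w → Repeated w
  hasRepeat⇒repeated (a ∷ v) (zero , zero , i≢j , _) = contradiction refl i≢j
  hasRepeat⇒repeated (a ∷ v) (zero , suc j , _ , eq) =
    now (subst (_∈ toList v) (sym eq) (∈-toList⁺ (∈-lookupᵥ j v)))
  hasRepeat⇒repeated (a ∷ v) (suc i , zero , _ , eq) =
    now (subst (_∈ toList v) eq (∈-toList⁺ (∈-lookupᵥ i v)))
  hasRepeat⇒repeated (a ∷ v) (suc i , suc j , i≢j , eq) =
    later (hasRepeat⇒repeated v (i , j , (λ i≡j → i≢j (cong suc i≡j)) , eq))

  repeated⇒hasRepeat : ∀ {j} (w : Word k j) → Repeated w → HasRepeat w
  repeated⇒hasRepeat (a ∷ v) (now a∈v) =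
    zero , suc (Anyᵥ.index (∈-toList⁻ a∈v)) , (λ ()) , lookup-index (∈-toList⁻ a∈v)
  repeated⇒hasRepeat (a ∷ v) (later r) with repeated⇒hasRepeat v r
  ... | i , j , i≢j , eq = suc i , suc j , (λ si≡sj → i≢j (Finₚ.suc-injective si≡sj)) , eq

module RepeatedLetters (k m : ℕ) where

  W : Set
  W = Word (suc k) (3 + m)

  hub : W
  hub = Vec.replicate (3 + m) zero

  Reach : W → W → Set
  Reach = Star (Link Repeated)

  fill : W → W
  fill = shiftWithᵥ (const zero)

  Ready : W → Set
  Ready y = Repeated (zero ∷ tail y)

  -- Filling a ready word takes two links: overwrite the first letter (same
  -- tail), then rotate.
  reach-fill : ∀ {y} → Repeated y → Ready y → Reach y (fill y)
  reach-fill {a ∷ t} ry ready = (ry , inj₂ refl) ◅ (ready , inj₁ refl) ◅ ε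

  -- A filled word ends in 0, so it is ready again.
  fill-ready : ∀ y → Ready (fill y)
  fill-ready (a ∷ b ∷ t) = now (∈-∷ʳ t zero)

  fill-repeated : ∀ {y} → Ready y → Repeated (fill y)
  fill-repeated {a ∷ t} ready = repeated-rot ready

  fills : ∀ j {y} → Repeated y → Ready y → Reach y (iterate fill y j)
  fills zero ry ready = ε
  fills (suc j) {y} ry ready = reach-fill ry ready ◅◅ fills j (fill-repeated {y} ready) (fill-ready y)

  -- m+3 fills turn any word into the all-zero word.
  ready⇒hub : ∀ {y} → Repeated y → Ready y → Reach y hub
  ready⇒hub {y} ry ready = subst (Reach y) (trans (shiftWithᵥ-all (const zero) y) (Vecₚ.map-const y zero))
                             (fills (3 + m) ry ready)

  -- Every word with a repeated letter reaches a ready word within two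
  -- rotations: either the repetition lies in its tail, or the first letter
  -- recurs and one or two rotations bring both occurrences into the tail.
  reach-hub : ∀ {w} → Repeated w → Reach w hub
  reach-hub {a ∷ b ∷ c ∷ t} r@(later r′) = ready⇒hub r (later r′)
  reach-hub {a ∷ b ∷ c ∷ t} r@(now (here refl)) =
    (r , inj₁ refl) ◅ (repeated-rot r , inj₁ refl) ◅
      ready⇒hub (repeated-rot (repeated-rot r)) (later (repeated-∷ʳ (t ∷ʳ a) (∈-∷ʳ t a)))
  reach-hub {a ∷ b ∷ c ∷ t} r@(now (there a∈ct)) =
    (r , inj₁ refl) ◅ ready⇒hub (repeated-rot r) (later (repeated-∷ʳ (c ∷ t) a∈ct))

  ucycle : HasUCycle (suc k) (3 + m) HasRepeat
  ucycle = ucycle-resp (repeated⇒hasRepeat _) (hasRepeat⇒repeated _)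
    (CycleJoining.ucycle Repeated (λ w → repeats? Fin._≟_ (toList w)) repeated-rot
       (words (suc k) (3 + m)) (λ {w} _ → words-complete w) hub (now (here refl)) reach-hub)

theorem5 : (k n : ℕ) → 1 ≤ k → 4 ≤ n → HasUCycle k n HasRepeat
theorem5 zero _ () _
theorem5 (suc k) (suc (suc (suc (suc m)))) _ (s≤s (s≤s (s≤s (s≤s _)))) = RepeatedLetters.ucycle k (suc m)
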